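{- For $n\geqslant 0$, $$\sigma\,\mathrm{mex}(n)=\sum_{j=0}^{n}\mathrm{pod}(j)\,D_2^*(n-j).$$
   Context: For a partition $\lambda$, $\mathrm{mex}(\lambda)$ is the smallest positive integer that is not a part of $\lambda$ (the empty partition has mex $1$). $\sigma\,\mathrm{mex}(n)$ is the sum of $\mathrm{mex}(\lambda)$ over all partitions $\lambda$ of $n$. $\mathrm{pod}(m)$ is the number of partitions of $m$ in which odd parts are not repeated. $D_2^*(m)$ is the number of partitions of $m$ into distinct parts using two colors $0$ and $1$ (no colored part repeated) such that the parts of color $0$ are exactly $1,2,\dots,j$ for some $j\geqslant 0$ and only even parts can have color $1$. -}

module Defs where

open import Data.Nat using (ℕ; zero; suc; _+_; _*_; _∸_; _≤_; _<_; _≟_; _≤?_)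
open import Data.Nat.Properties using ()
open import Data.Nat.Base using (_%_)
open import Data.List using (List; []; _∷_; length; filter; concatMap; upTo; map; applyUpTo)
open import Data.Nat.ListAction using (sum)
open import Data.Bool.ListAction using (all)
open import Relation.Nullary.Decidable using (T?)
open import Data.Bool using (Bool; true; false; _∧_; not; if_then_else_)
open import Relation.Nullary.Decidable using (⌊_⌋)

-- A partition is represented as a weakly decreasing list of positive parts.
-- partsBounded m n : all partitions of n with every part ≤ m (listed as
-- weakly decreasing lists).
partsBounded : ℕ → ℕ → List (List ℕ)
partsBounded m n = go n n m
  where
  -- go fuel n m : partitions of n with largest part ≤ m ; fuel ≥ n
  go : ℕ → ℕ → ℕ → List (List ℕ)
  go fuel zero m = [] ∷ []
  go zero (suc n) m = []
  go (suc fuel) (suc n) m =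
    concatMap (λ k → map (k ∷_) (go fuel (suc n ∸ k) k))
      (filter (λ k → k ≤? m) (applyUpTo suc (suc n)))

partitions : ℕ → List (List ℕ)
partitions n = partsBounded n n

_∈ᵇ_ : ℕ → List ℕ → Bool
x ∈ᵇ [] = false
x ∈ᵇ (y ∷ ys) = if ⌊ x ≟ y ⌋ then true else (x ∈ᵇ ys)

mexFrom : ℕ → ℕ → List ℕ → ℕ
mexFrom zero k λ' = k
mexFrom (suc fuel) k λ' = if k ∈ᵇ λ' then mexFrom fuel (suc k) λ' else k

-- the mex is at most length λ + 1, so fuel length λ + 1 suffices
mex : List ℕ → ℕ
mex λ' = mexFrom (suc (length λ')) 1 λ'

σmex : ℕ → ℕ
σmex n = sum (map mex (partitions n))

count : ℕ → List ℕ → ℕ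
count x [] = 0
count x (y ∷ ys) = if ⌊ x ≟ y ⌋ then suc (count x ys) else count x ys

isOdd : ℕ → Bool
isOdd n = ⌊ n % 2 ≟ 1 ⌋

isEven : ℕ → Bool
isEven n = ⌊ n % 2 ≟ 0 ⌋

oddPartsDistinct : List ℕ → Bool
oddPartsDistinct λ' = all (λ x → not (isOdd x) ∨' ⌊ count x λ' ≤? 1 ⌋) λ'
  where
  _∨'_ : Bool → Bool → Bool
  true ∨' _ = true
  false ∨' b = b

pod : ℕ → ℕ
pod m = length (filter (λ λ' → T? (oddPartsDistinct λ')) (partitions m))

distinctEven : List ℕ → Bool
distinctEven λ' = all (λ x → isEven x ∧ ⌊ count x λ' ≤? 1 ⌋) λ'

distinctEvenCount : ℕ → ℕ
distinctEvenCount m = length (filter (λ λ' → T? (distinctEven λ')) (partitions m))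

tri : ℕ → ℕ
tri zero = 0
tri (suc j) = suc j + tri j

-- D₂*(m): a two-coloured distinct partition whose colour-0 parts are exactly
-- {1,…,j} (contributing tri j) and whose colour-1 parts are distinct even parts.
-- Such an object is a pair (j, μ) with μ a distinct-even partition of m - tri j;
-- j ranges over 0..m (tri j ≤ m forces j ≤ m).
D₂* : ℕ → ℕ
D₂* m = sum (map (λ j → if ⌊ tri j ≤? m ⌋ then distinctEvenCount (m ∸ tri j) else 0)
                 (upTo (suc m)))

Σ≤ : ℕ → (ℕ → ℕ) → ℕ
Σ≤ n f = sum (map f (upTo (suc n)))

{-# OPTIONS --safe #-}

-- Since mex μ = Σ_{t ≥ 0} [1, …, t all occur in μ], and deleting one copy of each of 1, …, t
-- leaves an arbitrary partition of n − t(t+1)/2, the generating function of σmex is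
-- Σ_t q^(t(t+1)/2) / (q;q)∞.  Euler's factorisation
--   1 / (q;q)∞ = ∏_k (1 + q^(2k−1)) / (1 − q^(2k)) · ∏_k (1 + q^(2k)),
-- which holds factorwise by 1 / (1 − x) = (1 + x) / (1 − x²), splits 1 / (q;q)∞ into the
-- generating functions of pod and of partitions into distinct even parts, and the latter times
-- Σ_t q^(t(t+1)/2) is the generating function of D₂*.  Weighted partition counts are turned into
-- products by peeling off the largest part.

module Submission where

open import Data.Bool using (Bool; true; false; not; _∧_; _∨_; if_then_else_; T)
open import Data.Bool.ListAction using (all)
open import Data.Empty using (⊥; ⊥-elim)
open import Data.Fin using (Fin; toℕ)
open import Data.Fin.Properties using (pigeonhole; toℕ<n)
open import Data.List using (List; []; _∷_; _++_; map; filter; concatMap; applyUpTo; length; lookup)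
open import Data.List.Membership.Propositional using (_∈_)
open import Data.List.Properties using (map-∘; map-++; map-applyUpTo)
open import Data.List.Relation.Unary.All as All using (All; []; _∷_)
open import Data.List.Relation.Unary.Any using (here; there; index)
open import Data.List.Relation.Unary.Any.Properties using (lookup-index)
open import Data.Nat using (ℕ; zero; suc; pred; _+_; _*_; _∸_; _≤_; _<_; _≤ᵇ_; z≤n; s≤s; _%_; _≟_; _≤?_)
open import Data.Nat.DivMod using (m<n⇒m%n≡m; [m+n]%n≡m%n)
open import Data.Nat.Induction using (<-rec)
open import Data.Nat.ListAction using (sum)
open import Data.Nat.ListAction.Properties using (sum-++)
open import Data.Nat.Properties
open import Algebra.Properties.CommutativeSemigroup +-commutativeSemigroup using (interchange)
open import Data.Product using (_×_; _,_; ∃₂)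
open import Data.Sum using (_⊎_; inj₁; inj₂)
open import Function using (_∘_)
open import Relation.Binary.PropositionalEquality
  using (_≡_; _≗_; _≢_; refl; sym; trans; cong; cong₂; subst; module ≡-Reasoning)
open import Relation.Nullary using (Dec; yes; no; does)
open import Relation.Nullary.Decidable using (⌊_⌋; isYes≗does; T?)
open import Relation.Unary using (Decidable)

open import Defs

open ≡-Reasoning

∑< : ℕ → (ℕ → ℕ) → ℕ
∑< zero    f = 0
∑< (suc n) f = f 0 + ∑< n (f ∘ suc)

syntax ∑< n (λ i → e) = ∑[ i < n ] e

∑-cong : ∀ n {f g} → (∀ i → i < n → f i ≡ g i) → ∑< n f ≡ ∑< n g
∑-cong zero    eq = refl
∑-cong (suc n) eq = cong₂ _+_ (eq 0 (s≤s z≤n)) (∑-cong n (λ i i<n → eq (suc i) (s≤s i<n)))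

∑-vanishing : ∀ n {f} → (∀ i → i < n → f i ≡ 0) → ∑< n f ≡ 0
∑-vanishing zero    eq = refl
∑-vanishing (suc n) eq = cong₂ _+_ (eq 0 (s≤s z≤n)) (∑-vanishing n (λ i i<n → eq (suc i) (s≤s i<n)))

∑-0 : ∀ n → ∑[ i < n ] 0 ≡ 0
∑-0 n = ∑-vanishing n (λ _ _ → refl)

∑-distrib-+ : ∀ n f g → ∑[ i < n ] (f i + g i) ≡ ∑< n f + ∑< n g
∑-distrib-+ zero    f g = refl
∑-distrib-+ (suc n) f g =
  trans (cong (f 0 + g 0 +_) (∑-distrib-+ n (f ∘ suc) (g ∘ suc))) (interchange (f 0) (g 0) _ _)

*-distribˡ-∑ : ∀ n c f → c * ∑< n f ≡ ∑[ i < n ] (c * f i)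
*-distribˡ-∑ zero    c f = *-zeroʳ c
*-distribˡ-∑ (suc n) c f = trans (*-distribˡ-+ c (f 0) _) (cong (c * f 0 +_) (*-distribˡ-∑ n c (f ∘ suc)))

*-distribʳ-∑ : ∀ n c f → ∑< n f * c ≡ ∑[ i < n ] (f i * c)
*-distribʳ-∑ zero    c f = refl
*-distribʳ-∑ (suc n) c f = trans (*-distribʳ-+ c (f 0) _) (cong (f 0 * c +_) (*-distribʳ-∑ n c (f ∘ suc)))

∑-init-last : ∀ n f → ∑< (suc n) f ≡ ∑< n f + f n
∑-init-last zero    f = +-identityʳ (f 0)
∑-init-last (suc n) f = trans (cong (f 0 +_) (∑-init-last n (f ∘ suc))) (sym (+-assoc (f 0) _ _))

∑-comm : ∀ m n (a : ℕ → ℕ → ℕ) → ∑[ i < m ] ∑[ j < n ] a i j ≡ ∑[ j < n ] ∑[ i < m ] a i j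
∑-comm zero    n a = sym (∑-0 n)
∑-comm (suc m) n a =
  trans (cong (∑< n (a 0) +_) (∑-comm m n (a ∘ suc))) (sym (∑-distrib-+ n (a 0) _))

∑-reverse : ∀ n f → ∑< n f ≡ ∑[ i < n ] f (n ∸ suc i)
∑-reverse zero    f = refl
∑-reverse (suc n) f = begin
  f 0 + ∑< n (f ∘ suc)                 ≡⟨ cong (f 0 +_) (∑-reverse n (f ∘ suc)) ⟩
  f 0 + ∑[ i < n ] f (suc (n ∸ suc i)) ≡⟨ +-comm (f 0) _ ⟩
  ∑[ i < n ] f (suc (n ∸ suc i)) + f 0 ≡⟨ cong₂ _+_ (∑-cong n (λ i i<n → cong f (sym (+-∸-assoc 1 i<n))))
                                                     (cong f (sym (n∸n≡0 n))) ⟩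
  ∑[ i < n ] f (suc n ∸ suc i) + f (n ∸ n) ≡⟨ ∑-init-last n (λ i → f (n ∸ i)) ⟨
  ∑[ i < suc n ] f (n ∸ i)             ∎

∑-pad : ∀ m d f → (∀ i → m ≤ i → f i ≡ 0) → ∑< (m + d) f ≡ ∑< m f
∑-pad zero    d f eq = ∑-vanishing d (λ i _ → eq i z≤n)
∑-pad (suc m) d f eq = cong (f 0 +_) (∑-pad m d (f ∘ suc) (λ i m≤i → eq (suc i) (s≤s m≤i)))

∑-extend : ∀ {m n} f → m ≤ n → (∀ i → m ≤ i → f i ≡ 0) → ∑< n f ≡ ∑< m f
∑-extend {m} {n} f m≤n eq = trans (cong (λ k → ∑< k f) (sym (m+[n∸m]≡n m≤n))) (∑-pad m (n ∸ m) f eq)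

∑-range-stable : ∀ {m n} f → (∀ i → m ≤ i → f i ≡ 0) → (∀ i → n ≤ i → f i ≡ 0) → ∑< m f ≡ ∑< n f
∑-range-stable {m} {n} f vanish-m vanish-n with ≤-total m n
... | inj₁ m≤n = sym (∑-extend f m≤n vanish-m)
... | inj₂ n≤m = ∑-extend f n≤m vanish-n

∑-triangle : ∀ n (a : ℕ → ℕ → ℕ) →
             ∑[ k < suc n ] ∑[ i < suc k ] a i k ≡ ∑[ i < suc n ] ∑[ j < suc (n ∸ i) ] a i (i + j)
∑-triangle zero    a = refl
∑-triangle (suc n) a = begin
  (a 0 0 + 0) + ∑[ k < suc n ] (a 0 (suc k) + ∑[ i < suc k ] a (suc i) (suc k))
    ≡⟨ cong (a 0 0 + 0 +_) (∑-distrib-+ (suc n) (λ k → a 0 (suc k)) (λ k → ∑[ i < suc k ] a (suc i) (suc k))) ⟩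
  (a 0 0 + 0) + (∑[ k < suc n ] a 0 (suc k) + ∑[ k < suc n ] ∑[ i < suc k ] a (suc i) (suc k))
    ≡⟨ cong₂ (λ x y → x + (∑[ k < suc n ] a 0 (suc k) + y))
             (+-identityʳ (a 0 0)) (∑-triangle n (λ i k → a (suc i) (suc k))) ⟩
  a 0 0 + (∑[ k < suc n ] a 0 (suc k) + ∑[ i < suc n ] ∑[ j < suc (n ∸ i) ] a (suc i) (suc i + j))
    ≡⟨ +-assoc (a 0 0) _ _ ⟨
  (a 0 0 + ∑[ k < suc n ] a 0 (suc k)) + ∑[ i < suc n ] ∑[ j < suc (n ∸ i) ] a (suc i) (suc i + j)
    ∎

-- Power series over ℕ as coefficient sequences; `shift k` multiplies by q^k.  Factor k of a
-- product belongs to the part size k + 1: `geometric k` is 1 / (1 − q^(k+1)) and `onePlus k`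
-- is 1 + q^(k+1).
Series : Set
Series = ℕ → ℕ

δ : Series
δ zero    = 1
δ (suc _) = 0

infixl 6 _⊕_
infixl 7 _∗_

_⊕_ : Series → Series → Series
(f ⊕ g) n = f n + g n

shift : ℕ → Series → Series
shift zero    f n       = f n
shift (suc k) f zero    = 0
shift (suc k) f (suc n) = shift k f n

-- Opaque, so that unification sees `f ∗ g` rather than the unfolded sum.
opaque
  _∗_ : Series → Series → Series
  (f ∗ g) n = ∑[ i < suc n ] (f i * g (n ∸ i))

  ∗-def : ∀ f g n → (f ∗ g) n ≡ ∑[ i < suc n ] (f i * g (n ∸ i))
  ∗-def f g n = refl

  ∗-cong-≤ : ∀ n {f f′ g g′} → (∀ i → i ≤ n → f i ≡ f′ i) → (∀ i → i ≤ n → g i ≡ g′ i) →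
             (f ∗ g) n ≡ (f′ ∗ g′) n
  ∗-cong-≤ n eqf eqg = ∑-cong (suc n) (λ i i≤n → cong₂ _*_ (eqf i (≤-pred i≤n)) (eqg (n ∸ i) (m∸n≤m n i)))

  ∗-cong : ∀ {f f′ g g′} → f ≗ f′ → g ≗ g′ → f ∗ g ≗ f′ ∗ g′
  ∗-cong eqf eqg n = ∗-cong-≤ n (λ i _ → eqf i) (λ i _ → eqg i)

  ∗-comm : ∀ f g → f ∗ g ≗ g ∗ f
  ∗-comm f g n = begin
    ∑[ i < suc n ] (f i * g (n ∸ i))             ≡⟨ ∑-reverse (suc n) (λ i → f i * g (n ∸ i)) ⟩
    ∑[ i < suc n ] (f (n ∸ i) * g (n ∸ (n ∸ i))) ≡⟨ ∑-cong (suc n) (λ i i≤n → begin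
        f (n ∸ i) * g (n ∸ (n ∸ i)) ≡⟨ cong (λ j → f (n ∸ i) * g j) (m∸[m∸n]≡n (≤-pred i≤n)) ⟩
        f (n ∸ i) * g i             ≡⟨ *-comm (f (n ∸ i)) (g i) ⟩
        g i * f (n ∸ i)             ∎) ⟩
    ∑[ i < suc n ] (g i * f (n ∸ i))             ∎

  ∗-assoc : ∀ f g h → (f ∗ g) ∗ h ≗ f ∗ (g ∗ h)
  ∗-assoc f g h n = begin
    ∑[ k < suc n ] ((f ∗ g) k * h (n ∸ k))
      ≡⟨ ∑-cong (suc n) (λ k _ → *-distribʳ-∑ (suc k) (h (n ∸ k)) (λ i → f i * g (k ∸ i))) ⟩
    ∑[ k < suc n ] ∑[ i < suc k ] (f i * g (k ∸ i) * h (n ∸ k))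
      ≡⟨ ∑-triangle n (λ i k → f i * g (k ∸ i) * h (n ∸ k)) ⟩
    ∑[ i < suc n ] ∑[ j < suc (n ∸ i) ] (f i * g (i + j ∸ i) * h (n ∸ (i + j)))
      ≡⟨ ∑-cong (suc n) (λ i _ → ∑-cong (suc (n ∸ i)) (λ j _ → reassociate i j)) ⟩
    ∑[ i < suc n ] ∑[ j < suc (n ∸ i) ] (f i * (g j * h (n ∸ i ∸ j)))
      ≡⟨ ∑-cong (suc n) (λ i _ → sym (*-distribˡ-∑ (suc (n ∸ i)) (f i) (λ j → g j * h (n ∸ i ∸ j)))) ⟩
    ∑[ i < suc n ] (f i * (g ∗ h) (n ∸ i))
      ∎
    where
    reassociate : ∀ i j → f i * g (i + j ∸ i) * h (n ∸ (i + j)) ≡ f i * (g j * h (n ∸ i ∸ j))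
    reassociate i j = begin
      f i * g (i + j ∸ i) * h (n ∸ (i + j))
        ≡⟨ cong₂ (λ a b → f i * g a * h b) (m+n∸m≡n i j) (sym (∸-+-assoc n i j)) ⟩
      f i * g j * h (n ∸ i ∸ j)
        ≡⟨ *-assoc (f i) (g j) _ ⟩
      f i * (g j * h (n ∸ i ∸ j))
        ∎

  ∗-identityˡ : ∀ f → δ ∗ f ≗ f
  ∗-identityˡ f n = begin
    f (n ∸ 0) + 0 + ∑[ i < n ] 0 ≡⟨ cong (f n + 0 +_) (∑-0 n) ⟩
    f n + 0 + 0                  ≡⟨ cong (_+ 0) (+-identityʳ (f n)) ⟩
    f n + 0                      ≡⟨ +-identityʳ (f n) ⟩
    f n                          ∎

  ∗-distribʳ-⊕ : ∀ f g h → (f ⊕ g) ∗ h ≗ f ∗ h ⊕ g ∗ h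
  ∗-distribʳ-⊕ f g h n = begin
    ∑[ i < suc n ] ((f i + g i) * h (n ∸ i))
      ≡⟨ ∑-cong (suc n) (λ i _ → *-distribʳ-+ (h (n ∸ i)) (f i) (g i)) ⟩
    ∑[ i < suc n ] (f i * h (n ∸ i) + g i * h (n ∸ i))
      ≡⟨ ∑-distrib-+ (suc n) (λ i → f i * h (n ∸ i)) (λ i → g i * h (n ∸ i)) ⟩
    (f ∗ h) n + (g ∗ h) n
      ∎

  ∗-distribˡ-∑ : ∀ N f (g : ℕ → Series) n → (f ∗ (λ m → ∑[ t < N ] g t m)) n ≡ ∑[ t < N ] (f ∗ g t) n
  ∗-distribˡ-∑ N f g n = begin
    ∑[ i < suc n ] (f i * ∑[ t < N ] g t (n ∸ i))
      ≡⟨ ∑-cong (suc n) (λ i _ → *-distribˡ-∑ N (f i) (λ t → g t (n ∸ i))) ⟩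
    ∑[ i < suc n ] ∑[ t < N ] (f i * g t (n ∸ i))
      ≡⟨ ∑-comm (suc n) N (λ i t → f i * g t (n ∸ i)) ⟩
    ∑[ t < N ] (f ∗ g t) n
      ∎

  shift-∗ : ∀ k f g → shift k f ∗ g ≗ shift k (f ∗ g)
  shift-∗ zero    f g n       = refl
  shift-∗ (suc k) f g zero    = refl
  shift-∗ (suc k) f g (suc n) = shift-∗ k f g n

∗-congˡ : ∀ {f f′} g → f ≗ f′ → f ∗ g ≗ f′ ∗ g
∗-congˡ g eqf = ∗-cong eqf (λ _ → refl)

∗-congʳ : ∀ f {g g′} → g ≗ g′ → f ∗ g ≗ f ∗ g′
∗-congʳ f eqg = ∗-cong (λ _ → refl) eqg

∗-interchange : ∀ f g h k → (f ∗ g) ∗ (h ∗ k) ≗ (f ∗ h) ∗ (g ∗ k)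
∗-interchange f g h k n = begin
  ((f ∗ g) ∗ (h ∗ k)) n ≡⟨ ∗-assoc f g (h ∗ k) n ⟩
  (f ∗ (g ∗ (h ∗ k))) n ≡⟨ ∗-congʳ f (λ m → sym (∗-assoc g h k m)) n ⟩
  (f ∗ ((g ∗ h) ∗ k)) n ≡⟨ ∗-congʳ f (∗-congˡ k (∗-comm g h)) n ⟩
  (f ∗ ((h ∗ g) ∗ k)) n ≡⟨ ∗-congʳ f (∗-assoc h g k) n ⟩
  (f ∗ (h ∗ (g ∗ k))) n ≡⟨ ∗-assoc f h (g ∗ k) n ⟨
  ((f ∗ h) ∗ (g ∗ k)) n ∎

shift-cong-≤ : ∀ k n {f g} → (∀ j → j ≤ n → f j ≡ g j) → shift k f n ≡ shift k g n
shift-cong-≤ zero    n       eq = eq n ≤-refl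
shift-cong-≤ (suc k) zero    eq = refl
shift-cong-≤ (suc k) (suc n) eq = shift-cong-≤ k n (λ j j≤n → eq j (m≤n⇒m≤1+n j≤n))

shift-cong : ∀ k {f g} → f ≗ g → shift k f ≗ shift k g
shift-cong k eq n = shift-cong-≤ k n (λ j _ → eq j)

shift-suc-cong-< : ∀ k n {f g} → (∀ {j} → j < n → f j ≡ g j) → shift (suc k) f n ≡ shift (suc k) g n
shift-suc-cong-< k zero    eq = refl
shift-suc-cong-< k (suc n) eq = shift-cong-≤ k n (λ j j≤n → eq (s≤s j≤n))

shift-below : ∀ k f n → n < k → shift k f n ≡ 0
shift-below (suc k) f zero    _         = refl
shift-below (suc k) f (suc n) (s≤s n<k) = shift-below k f n n<k

shift-0 : ∀ k n → shift k (λ _ → 0) n ≡ 0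
shift-0 zero    n       = refl
shift-0 (suc k) zero    = refl
shift-0 (suc k) (suc n) = shift-0 k n

shift-offset : ∀ k f n → shift k f (k + n) ≡ f n
shift-offset zero    f n = refl
shift-offset (suc k) f n = shift-offset k f n

shift-+ : ∀ k l f → shift (k + l) f ≗ shift k (shift l f)
shift-+ zero    l f n       = refl
shift-+ (suc k) l f zero    = refl
shift-+ (suc k) l f (suc n) = shift-+ k l f n

shift-comm : ∀ k l f → shift k (shift l f) ≗ shift l (shift k f)
shift-comm k l f n = begin
  shift k (shift l f) n ≡⟨ shift-+ k l f n ⟨
  shift (k + l) f n     ≡⟨ cong (λ j → shift j f n) (+-comm k l) ⟩
  shift (l + k) f n     ≡⟨ shift-+ l k f n ⟩
  shift l (shift k f) n ∎

shift-⊕ : ∀ k f g → shift k (f ⊕ g) ≗ shift k f ⊕ shift k g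
shift-⊕ zero    f g n       = refl
shift-⊕ (suc k) f g zero    = refl
shift-⊕ (suc k) f g (suc n) = shift-⊕ k f g n

shift-≤ᵇ : ∀ k f n → shift k f n ≡ (if k ≤ᵇ n then f (n ∸ k) else 0)
shift-≤ᵇ zero          f n       = refl
shift-≤ᵇ (suc k)       f zero    = refl
shift-≤ᵇ (suc zero)    f (suc n) = refl
shift-≤ᵇ (suc (suc k)) f (suc n) = shift-≤ᵇ (suc k) f n

∗-shift : ∀ k f g → f ∗ shift k g ≗ shift k (f ∗ g)
∗-shift k f g n = begin
  (f ∗ shift k g) n ≡⟨ ∗-comm f (shift k g) n ⟩
  (shift k g ∗ f) n ≡⟨ shift-∗ k g f n ⟩
  shift k (g ∗ f) n ≡⟨ shift-cong k (∗-comm g f) n ⟩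
  shift k (f ∗ g) n ∎

shift-fixpoint-unique : ∀ k h {f g} → f ≗ h ⊕ shift (suc k) f → g ≗ h ⊕ shift (suc k) g → f ≗ g
shift-fixpoint-unique k h {f} {g} eqf eqg = <-rec (λ n → f n ≡ g n) agree
  where
  agree : ∀ n → (∀ {j} → j < n → f j ≡ g j) → f n ≡ g n
  agree n rec = trans (eqf n) (trans (cong (h n +_) (shift-suc-cong-< k n rec)) (sym (eqg n)))

geometric : ℕ → Series
geometric k n = δ (n % suc k)

onePlus : ℕ → Series
onePlus k = δ ⊕ shift (suc k) δ

geometric-below : ∀ k n → n ≤ k → geometric k n ≡ δ n
geometric-below k n n≤k = cong δ (m<n⇒m%n≡m (s≤s n≤k))

geometric-unfold : ∀ k → geometric k ≗ δ ⊕ shift (suc k) (geometric k)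
geometric-unfold k n with n ≤? k
... | yes n≤k = begin
  geometric k n                           ≡⟨ geometric-below k n n≤k ⟩
  δ n                                     ≡⟨ +-identityʳ (δ n) ⟨
  δ n + 0                                 ≡⟨ cong (δ n +_) (shift-below (suc k) (geometric k) n (s≤s n≤k)) ⟨
  δ n + shift (suc k) (geometric k) n     ∎
... | no n≰k = subst (λ m → geometric k m ≡ δ m + shift (suc k) (geometric k) m)
                     (m+[n∸m]≡n (≰⇒> n≰k)) (periodic (n ∸ suc k))
  where
  periodic : ∀ j → geometric k (suc k + j) ≡ shift (suc k) (geometric k) (suc k + j)
  periodic j = begin
    δ ((suc k + j) % suc k)                 ≡⟨ cong (λ m → δ (m % suc k)) (+-comm (suc k) j) ⟩
    δ ((j + suc k) % suc k)                 ≡⟨ cong δ ([m+n]%n≡m%n j (suc k)) ⟩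
    geometric k j                           ≡⟨ shift-offset (suc k) (geometric k) j ⟨
    shift (suc k) (geometric k) (suc k + j) ∎

onePlus-∗ : ∀ k f → onePlus k ∗ f ≗ f ⊕ shift (suc k) f
onePlus-∗ k f n = begin
  (onePlus k ∗ f) n                          ≡⟨ ∗-distribʳ-⊕ δ (shift (suc k) δ) f n ⟩
  (δ ∗ f) n + (shift (suc k) δ ∗ f) n        ≡⟨ cong₂ _+_ (∗-identityˡ f n) (shift-∗ (suc k) δ f n) ⟩
  f n + shift (suc k) (δ ∗ f) n              ≡⟨ cong (f n +_) (shift-cong (suc k) (∗-identityˡ f) n) ⟩
  f n + shift (suc k) f n                    ∎

geometric-∗ : ∀ k f → geometric k ∗ f ≗ f ⊕ shift (suc k) (geometric k ∗ f)
geometric-∗ k f n = begin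
  (geometric k ∗ f) n
    ≡⟨ ∗-congˡ f (geometric-unfold k) n ⟩
  ((δ ⊕ shift (suc k) (geometric k)) ∗ f) n
    ≡⟨ ∗-distribʳ-⊕ δ _ f n ⟩
  (δ ∗ f) n + (shift (suc k) (geometric k) ∗ f) n
    ≡⟨ cong₂ _+_ (∗-identityˡ f n) (shift-∗ (suc k) (geometric k) f n) ⟩
  f n + shift (suc k) (geometric k ∗ f) n
    ∎

-- 1 / (1 − x) = (1 + x) / (1 − x²) with x = q^(k+1): both sides solve f = 1 + x f.
geometric-split : ∀ k → geometric k ≗ onePlus k ∗ geometric (k + suc k)
geometric-split k n = begin
  geometric k n                   ≡⟨ shift-fixpoint-unique k δ (geometric-unfold k) unfold n ⟩
  (g ⊕ shift (suc k) g) n         ≡⟨ onePlus-∗ k g n ⟨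
  (onePlus k ∗ g) n               ∎
  where
  g : Series
  g = geometric (k + suc k)
  unfold : g ⊕ shift (suc k) g ≗ δ ⊕ shift (suc k) (g ⊕ shift (suc k) g)
  unfold m = begin
    g m + shift (suc k) g m
      ≡⟨ cong (_+ shift (suc k) g m) (geometric-unfold (k + suc k) m) ⟩
    δ m + shift (suc k + suc k) g m + shift (suc k) g m
      ≡⟨ cong (λ x → δ m + x + shift (suc k) g m) (shift-+ (suc k) (suc k) g m) ⟩
    δ m + shift (suc k) (shift (suc k) g) m + shift (suc k) g m
      ≡⟨ +-assoc (δ m) _ _ ⟩
    δ m + (shift (suc k) (shift (suc k) g) m + shift (suc k) g m)
      ≡⟨ cong (δ m +_) (+-comm (shift (suc k) (shift (suc k) g) m) _) ⟩
    δ m + (shift (suc k) g m + shift (suc k) (shift (suc k) g) m)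
      ≡⟨ cong (δ m +_) (shift-⊕ (suc k) g (shift (suc k) g) m) ⟨
    δ m + shift (suc k) (g ⊕ shift (suc k) g) m
      ∎

∏< : (ℕ → Series) → ℕ → Series
∏< F zero    = δ
∏< F (suc m) = F m ∗ ∏< F m

∏-cong : ∀ {F G} → (∀ k → F k ≗ G k) → ∀ m → ∏< F m ≗ ∏< G m
∏-cong eq zero    n = refl
∏-cong eq (suc m) n = ∗-cong (eq m) (∏-cong eq m) n

∏-distrib-∗ : ∀ F G m → ∏< (λ k → F k ∗ G k) m ≗ ∏< F m ∗ ∏< G m
∏-distrib-∗ F G zero    n = sym (∗-identityˡ δ n)
∏-distrib-∗ F G (suc m) n = begin
  ((F m ∗ G m) ∗ ∏< (λ k → F k ∗ G k) m) n ≡⟨ ∗-congʳ (F m ∗ G m) (∏-distrib-∗ F G m) n ⟩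
  ((F m ∗ G m) ∗ (∏< F m ∗ ∏< G m)) n      ≡⟨ ∗-interchange (F m) (G m) (∏< F m) (∏< G m) n ⟩
  ((F m ∗ ∏< F m) ∗ (G m ∗ ∏< G m)) n      ∎

-- F k ≡ 1 modulo q^(k+1), so that ∏< F m stabilises degreewise as m grows.
TrivialBelow : (ℕ → Series) → Set
TrivialBelow F = ∀ k n → n ≤ k → F k n ≡ δ n

∏-suc-stable : ∀ {F} → TrivialBelow F → ∀ m n → n ≤ m → ∏< F (suc m) n ≡ ∏< F m n
∏-suc-stable {F} triv m n n≤m = begin
  (F m ∗ ∏< F m) n ≡⟨ ∗-cong-≤ n (λ i i≤n → triv m i (≤-trans i≤n n≤m)) (λ _ _ → refl) ⟩
  (δ ∗ ∏< F m) n   ≡⟨ ∗-identityˡ (∏< F m) n ⟩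
  ∏< F m n         ∎

∏-stable : ∀ {F} → TrivialBelow F → ∀ {m m′} n → n ≤ m → m ≤ m′ → ∏< F m′ n ≡ ∏< F m n
∏-stable triv {m} {m′} n n≤m m≤m′ with m≤n⇒m<n∨m≡n m≤m′
... | inj₂ refl = refl
... | inj₁ (s≤s m≤m″) = trans (∏-suc-stable triv _ n (≤-trans n≤m m≤m″)) (∏-stable triv n n≤m m≤m″)

geometric-trivialBelow : TrivialBelow geometric
geometric-trivialBelow = geometric-below

onePlus-trivialBelow : TrivialBelow onePlus
onePlus-trivialBelow k n n≤k =
  trans (cong (δ n +_) (shift-below (suc k) δ n (s≤s n≤k))) (+-identityʳ (δ n))

δ-trivialBelow : TrivialBelow (λ _ → δ)
δ-trivialBelow k n _ = refl

if-trivialBelow : ∀ {F G} (b : ℕ → Bool) → TrivialBelow F → TrivialBelow G →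
                  TrivialBelow (λ k → if b k then F k else G k)
if-trivialBelow b trivF trivG k with b k
... | true  = trivF k
... | false = trivG k

parity : ∀ n → (isOdd n ≡ true × isEven n ≡ false) ⊎ (isOdd n ≡ false × isEven n ≡ true)
parity zero          = inj₂ (refl , refl)
parity (suc zero)    = inj₁ (refl , refl)
parity (suc (suc n)) = parity n

isEven-double : ∀ j → isEven (j + j) ≡ true
isEven-double zero    = refl
isEven-double (suc j) = trans (cong (isEven ∘ suc) (+-suc j j)) (isEven-double j)

isEven-suc-double : ∀ j → isEven (suc (j + j)) ≡ false
isEven-suc-double zero    = refl
isEven-suc-double (suc j) = trans (cong (isEven ∘ suc ∘ suc) (+-suc j j)) (isEven-suc-double j)

podFactor : ℕ → Series
podFactor k = if isOdd (suc k) then onePlus k else geometric k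

distinctEvenFactor : ℕ → Series
distinctEvenFactor k = if isEven (suc k) then onePlus k else δ

evenGeometric : ℕ → Series
evenGeometric k = if isEven (suc k) then geometric k else δ

podFactor-trivialBelow : TrivialBelow podFactor
podFactor-trivialBelow = if-trivialBelow (isOdd ∘ suc) onePlus-trivialBelow geometric-trivialBelow

distinctEvenFactor-trivialBelow : TrivialBelow distinctEvenFactor
distinctEvenFactor-trivialBelow = if-trivialBelow (isEven ∘ suc) onePlus-trivialBelow δ-trivialBelow

evenGeometric-trivialBelow : TrivialBelow evenGeometric
evenGeometric-trivialBelow = if-trivialBelow (isEven ∘ suc) geometric-trivialBelow δ-trivialBelow

podFactor-∗-distinctEvenFactor : ∀ k → podFactor k ∗ distinctEvenFactor k ≗ onePlus k ∗ evenGeometric k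
podFactor-∗-distinctEvenFactor k with isOdd (suc k) | isEven (suc k) | parity (suc k)
... | true  | false | inj₁ _ = λ _ → refl
... | false | true  | inj₂ _ = ∗-comm (geometric k) (onePlus k)

∏-evenGeometric-double : ∀ j → ∏< evenGeometric (j + j) ≗ ∏< (λ k → geometric (k + suc k)) j
∏-evenGeometric-double zero    n = refl
∏-evenGeometric-double (suc j) n = begin
  ∏< evenGeometric (suc j + suc j) n
    ≡⟨ cong (λ m → ∏< evenGeometric (suc m) n) (+-suc j j) ⟩
  (evenGeometric (suc (j + j)) ∗ (evenGeometric (j + j) ∗ ∏< evenGeometric (j + j))) n
    ≡⟨ ∗-cong evenFactor (λ i → trans (∗-congˡ _ oddFactor i) (∗-identityˡ _ i)) n ⟩
  (geometric (suc (j + j)) ∗ ∏< evenGeometric (j + j)) n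
    ≡⟨ ∗-cong (λ i → cong (λ m → geometric m i) (sym (+-suc j j))) (∏-evenGeometric-double j) n ⟩
  ∏< (λ k → geometric (k + suc k)) (suc j) n
    ∎
  where
  evenFactor : evenGeometric (suc (j + j)) ≗ geometric (suc (j + j))
  evenFactor i rewrite isEven-double j = refl
  oddFactor : evenGeometric (j + j) ≗ δ
  oddFactor i rewrite isEven-suc-double j = refl

∏-podFactor-∗-∏-distinctEvenFactor : ∀ m n → n ≤ m →
  (∏< podFactor m ∗ ∏< distinctEvenFactor m) n ≡ ∏< geometric m n
∏-podFactor-∗-∏-distinctEvenFactor m n n≤m = begin
  (∏< podFactor m ∗ ∏< distinctEvenFactor m) n
    ≡⟨ ∏-distrib-∗ podFactor distinctEvenFactor m n ⟨
  ∏< (λ k → podFactor k ∗ distinctEvenFactor k) m n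
    ≡⟨ ∏-cong podFactor-∗-distinctEvenFactor m n ⟩
  ∏< (λ k → onePlus k ∗ evenGeometric k) m n
    ≡⟨ ∏-distrib-∗ onePlus evenGeometric m n ⟩
  (∏< onePlus m ∗ ∏< evenGeometric m) n
    ≡⟨ ∗-cong-≤ n (λ _ _ → refl) (λ i i≤n →
         sym (∏-stable evenGeometric-trivialBelow i (≤-trans i≤n n≤m) (m≤m+n m m))) ⟩
  (∏< onePlus m ∗ ∏< evenGeometric (m + m)) n
    ≡⟨ ∗-congʳ (∏< onePlus m) (∏-evenGeometric-double m) n ⟩
  (∏< onePlus m ∗ ∏< (λ k → geometric (k + suc k)) m) n
    ≡⟨ ∏-distrib-∗ onePlus (λ k → geometric (k + suc k)) m n ⟨
  ∏< (λ k → onePlus k ∗ geometric (k + suc k)) m n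
    ≡⟨ ∏-cong (λ k → sym ∘ geometric-split k) m n ⟩
  ∏< geometric m n
    ∎

-- `partsBounded` recurses through a function local to its `where` block, which has no name
-- outside `Defs`.  Its one-step unfolding determines `partsBoundedInner`, and the
-- `with`-abstractions turn the arguments of `go` into distinct variables, so that
-- unification names the local function `go` (its first two arguments are unused).
partsBoundedInner : ℕ → ℕ → ℕ → List (List ℕ)
partsBounded-suc : ∀ m n → partsBounded m (suc n) ≡
  concatMap (λ k → map (k ∷_) (partsBoundedInner m n k)) (filter (_≤? m) (applyUpTo suc (suc n)))
partsBoundedInner = _
partsBounded-suc m n = refl

go : ℕ → ℕ → ℕ → ℕ → ℕ → List (List ℕ)
go≡partsBoundedInner : ∀ m n k → go m (suc n) n (suc n ∸ k) k ≡ partsBoundedInner m n k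
go = _
go≡partsBoundedInner m n k with suc n ∸ k
... | _ with suc n
...   | _ = refl

sum-applyUpTo : ∀ f n → sum (applyUpTo f n) ≡ ∑< n f
sum-applyUpTo f zero    = refl
sum-applyUpTo f (suc n) = cong (f 0 +_) (sum-applyUpTo (f ∘ suc) n)

sum-map-applyUpTo : ∀ (h f : ℕ → ℕ) n → sum (map h (applyUpTo f n)) ≡ ∑[ i < n ] h (f i)
sum-map-applyUpTo h f n = trans (cong sum (map-applyUpTo f h n)) (sum-applyUpTo (h ∘ f) n)

sum-map-concatMap : ∀ {A : Set} (h : A → ℕ) (F : ℕ → List A) ks →
                    sum (map h (concatMap F ks)) ≡ sum (map (λ k → sum (map h (F k))) ks)
sum-map-concatMap h F []       = refl
sum-map-concatMap h F (k ∷ ks) = begin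
  sum (map h (F k ++ concatMap F ks))               ≡⟨ cong sum (map-++ h (F k) (concatMap F ks)) ⟩
  sum (map h (F k) ++ map h (concatMap F ks))       ≡⟨ sum-++ (map h (F k)) _ ⟩
  sum (map h (F k)) + sum (map h (concatMap F ks))  ≡⟨ cong (sum (map h (F k)) +_) (sum-map-concatMap h F ks) ⟩
  sum (map h (F k)) + sum (map (λ k → sum (map h (F k))) ks) ∎

sum-map-filter : ∀ {A : Set} {P : A → Set} (P? : Decidable P) (h : A → ℕ) xs →
                 sum (map h (filter P? xs)) ≡ sum (map (λ x → if does (P? x) then h x else 0) xs)
sum-map-filter P? h []       = refl
sum-map-filter P? h (x ∷ xs) with does (P? x)
... | true  = cong (h x +_) (sum-map-filter P? h xs)
... | false = sum-map-filter P? h xs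

length-filter≡sum : ∀ {A : Set} {P : A → Set} (P? : Decidable P) xs →
                    length (filter P? xs) ≡ sum (map (λ x → if does (P? x) then 1 else 0) xs)
length-filter≡sum P? []       = refl
length-filter≡sum P? (x ∷ xs) with does (P? x)
... | true  = cong suc (length-filter≡sum P? xs)
... | false = length-filter≡sum P? xs

Weight : Set
Weight = List ℕ → ℕ

-- The sum of w over `go _ _ fuel n m` (see sum-map-go), organised by the largest part i + 1;
-- when n ≤ fuel that list holds all partitions of n with parts ≤ m.
partitionSum : ℕ → Weight → ℕ → ℕ → ℕ
partitionSum fuel       w zero    m = w []
partitionSum zero       w (suc n) m = 0
partitionSum (suc fuel) w (suc n) m =
  ∑[ i < suc n ] (if suc i ≤ᵇ m then partitionSum fuel (w ∘ (suc i ∷_)) (n ∸ i) (suc i) else 0)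

sum-map-go : ∀ a b fuel w n m → sum (map w (go a b fuel n m)) ≡ partitionSum fuel w n m
sum-map-go a b fuel       w zero    m = +-identityʳ (w [])
sum-map-go a b zero       w (suc n) m = refl
sum-map-go a b (suc fuel) w (suc n) m = begin
  sum (map w (concatMap (λ k → map (k ∷_) (inner k)) (filter (_≤? m) (applyUpTo suc (suc n)))))
    ≡⟨ sum-map-concatMap w (λ k → map (k ∷_) (inner k)) (filter (_≤? m) (applyUpTo suc (suc n))) ⟩
  sum (map (λ k → sum (map w (map (k ∷_) (inner k)))) (filter (_≤? m) (applyUpTo suc (suc n))))
    ≡⟨ sum-map-filter (_≤? m) (λ k → sum (map w (map (k ∷_) (inner k)))) (applyUpTo suc (suc n)) ⟩
  sum (map (λ k → if k ≤ᵇ m then sum (map w (map (k ∷_) (inner k))) else 0) (applyUpTo suc (suc n)))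
    ≡⟨ sum-map-applyUpTo _ suc (suc n) ⟩
  ∑[ i < suc n ] (if suc i ≤ᵇ m then sum (map w (map (suc i ∷_) (inner (suc i)))) else 0)
    ≡⟨ ∑-cong (suc n) (λ i _ → cong (λ x → if suc i ≤ᵇ m then x else 0) (begin
         sum (map w (map (suc i ∷_) (inner (suc i))))  ≡⟨ cong sum (map-∘ (inner (suc i))) ⟨
         sum (map (w ∘ (suc i ∷_)) (inner (suc i)))    ≡⟨ sum-map-go a b fuel (w ∘ (suc i ∷_)) (n ∸ i) (suc i) ⟩
         partitionSum fuel (w ∘ (suc i ∷_)) (n ∸ i) (suc i) ∎)) ⟩
  partitionSum (suc fuel) w (suc n) m
    ∎
  where
  inner : ℕ → List (List ℕ)
  inner k = go a b fuel (suc n ∸ k) k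

∑-guard-suc : ∀ N m (h : ℕ → ℕ) →
  ∑[ i < N ] (if suc i ≤ᵇ suc m then h i else 0) ≡
  ∑[ i < N ] (if suc i ≤ᵇ m then h i else 0) + (if suc m ≤ᵇ N then h m else 0)
∑-guard-suc zero    m       h = refl
∑-guard-suc (suc N) zero    h = begin
  h 0 + ∑[ i < N ] 0     ≡⟨ cong (h 0 +_) (∑-0 N) ⟩
  h 0 + 0                ≡⟨ +-comm (h 0) 0 ⟩
  0 + h 0                ≡⟨ cong (_+ h 0) (∑-0 N) ⟨
  ∑[ i < N ] 0 + h 0     ∎
∑-guard-suc (suc N) (suc m) h =
  trans (cong (h 0 +_) (∑-guard-suc N m (h ∘ suc))) (sym (+-assoc (h 0) _ _))

partitionSum-suc : ∀ fuel w n m → n ≤ fuel →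
  partitionSum fuel w n (suc m) ≡
  partitionSum fuel w n m + shift (suc m) (λ r → partitionSum (pred fuel) (w ∘ (suc m ∷_)) r (suc m)) n
partitionSum-suc fuel       w zero    m _ = sym (+-identityʳ (w []))
partitionSum-suc (suc fuel) w (suc n) m _ = begin
  ∑[ i < suc n ] (if suc i ≤ᵇ suc m then h i else 0)
    ≡⟨ ∑-guard-suc (suc n) m h ⟩
  ∑[ i < suc n ] (if suc i ≤ᵇ m then h i else 0) + (if suc m ≤ᵇ suc n then h m else 0)
    ≡⟨ cong (partitionSum (suc fuel) w (suc n) m +_) (shift-≤ᵇ (suc m) _ (suc n)) ⟨
  partitionSum (suc fuel) w (suc n) m + shift (suc m) (λ r → partitionSum fuel (w ∘ (suc m ∷_)) r (suc m)) (suc n)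
    ∎
  where
  h : ℕ → ℕ
  h i = partitionSum fuel (w ∘ (suc i ∷_)) (n ∸ i) (suc i)

if-congʳ : ∀ b {x y : ℕ} → (T b → x ≡ y) → (if b then x else 0) ≡ (if b then y else 0)
if-congʳ true  eq = eq _
if-congʳ false eq = refl

if-∑ : ∀ b N g → (if b then ∑< N g else 0) ≡ ∑[ t < N ] (if b then g t else 0)
if-∑ true  N g = refl
if-∑ false N g = sym (∑-0 N)

partitionSum-cong : ∀ fuel m n {w w′} → (∀ μ → All (_≤ m) μ → w μ ≡ w′ μ) →
                    partitionSum fuel w n m ≡ partitionSum fuel w′ n m
partitionSum-cong fuel       m zero    eq = eq [] []
partitionSum-cong zero       m (suc n) eq = refl
partitionSum-cong (suc fuel) m (suc n) eq = ∑-cong (suc n) (λ i _ → if-congʳ (suc i ≤ᵇ m) (λ i<ᵇm →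
  partitionSum-cong fuel (suc i) (n ∸ i) (λ μ μ≤i → eq (suc i ∷ μ) (bounded i<ᵇm μ≤i))))
  where
  bounded : ∀ {i μ} → T (suc i ≤ᵇ m) → All (_≤ suc i) μ → All (_≤ m) (suc i ∷ μ)
  bounded {i} i<ᵇm μ≤i = let i<m = ≤ᵇ⇒≤ (suc i) m i<ᵇm in i<m ∷ All.map (λ j≤i → ≤-trans j≤i i<m) μ≤i

partitionSum-∑ : ∀ N fuel n m (w : ℕ → Weight) →
                 partitionSum fuel (λ μ → ∑[ t < N ] w t μ) n m ≡ ∑[ t < N ] partitionSum fuel (w t) n m
partitionSum-∑ N fuel       zero    m w = refl
partitionSum-∑ N zero       (suc n) m w = sym (∑-0 N)
partitionSum-∑ N (suc fuel) (suc n) m w = begin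
  ∑[ i < suc n ] (if suc i ≤ᵇ m then partitionSum fuel (λ μ → ∑[ t < N ] w t (suc i ∷ μ)) (n ∸ i) (suc i) else 0)
    ≡⟨ ∑-cong (suc n) (λ i _ → trans (cong (λ x → if suc i ≤ᵇ m then x else 0)
                                             (partitionSum-∑ N fuel (n ∸ i) (suc i) (λ t → w t ∘ (suc i ∷_))))
                                       (if-∑ (suc i ≤ᵇ m) N _)) ⟩
  ∑[ i < suc n ] ∑[ t < N ] (if suc i ≤ᵇ m then partitionSum fuel (w t ∘ (suc i ∷_)) (n ∸ i) (suc i) else 0)
    ≡⟨ ∑-comm (suc n) N (λ i t → if suc i ≤ᵇ m then partitionSum fuel (w t ∘ (suc i ∷_)) (n ∸ i) (suc i) else 0) ⟩
  ∑[ t < N ] partitionSum (suc fuel) (w t) (suc n) m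
    ∎

partitionSum-vanishing : ∀ fuel m n {w} → (∀ μ → All (_≤ m) μ → w μ ≡ 0) → partitionSum fuel w n m ≡ 0
partitionSum-vanishing fuel m n eq = trans (partitionSum-cong fuel m n eq) (partitionSum-∑ 0 fuel n m (λ _ _ → 0))

data PartRule (w : Weight) (F : ℕ → Series) (k : ℕ) : Set where
  unrestricted : F k ≗ geometric k → (∀ μ → w (suc k ∷ μ) ≡ w μ) → PartRule w F k
  atMostOnce   : F k ≗ onePlus k → (∀ μ → All (_≤ k) μ → w (suc k ∷ μ) ≡ w μ) →
                 (∀ μ → w (suc k ∷ suc k ∷ μ) ≡ 0) → PartRule w F k
  forbidden    : F k ≗ δ → (∀ μ → w (suc k ∷ μ) ≡ 0) → PartRule w F k

module ProductFormula (w : Weight) (F : ℕ → Series) (F-trivialBelow : TrivialBelow F)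
                      (w[]≡1 : w [] ≡ 1) (rule : ∀ k → PartRule w F k) where

  partitionSum≡∏ : ∀ m fuel n → n ≤ fuel → partitionSum fuel w n m ≡ ∏< F m n
  partitionSum≡∏ m       fuel       zero    _            =
    trans w[]≡1 (sym (∏-stable F-trivialBelow {m′ = m} 0 z≤n z≤n))
  partitionSum≡∏ zero    (suc fuel) (suc n) _            = ∑-0 (suc n)
  partitionSum≡∏ (suc k) (suc fuel) (suc n) (s≤s n≤fuel) = begin
    partitionSum (suc fuel) w (suc n) (suc k)
      ≡⟨ partitionSum-suc (suc fuel) w (suc n) k (s≤s n≤fuel) ⟩
    partitionSum (suc fuel) w (suc n) k + shift k largest n
      ≡⟨ cong (_+ shift k largest n) (partitionSum≡∏ k (suc fuel) (suc n) (s≤s n≤fuel)) ⟩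
    P (suc n) + shift k largest n
      ≡⟨ addLargest (rule k) ⟩
    ∏< F (suc k) (suc n)
      ∎
    where
    P : Series
    P = ∏< F k

    largest : Series
    largest r = partitionSum fuel (w ∘ (suc k ∷_)) r (suc k)

    largest-cong : ∀ {G} → (∀ r → r ≤ fuel → largest r ≡ G r) → shift k largest n ≡ shift k G n
    largest-cong eq = shift-cong-≤ k n (λ r r≤n → eq r (≤-trans r≤n n≤fuel))

    addLargest : PartRule w F k → P (suc n) + shift k largest n ≡ ∏< F (suc k) (suc n)
    addLargest (unrestricted F≗geometric w-free) = begin
      P (suc n) + shift k largest n
        ≡⟨ cong (P (suc n) +_) (largest-cong (λ r r≤fuel →
             trans (partitionSum-cong fuel (suc k) r (λ μ _ → w-free μ)) (partitionSum≡∏ (suc k) fuel r r≤fuel))) ⟩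
      P (suc n) + shift (suc k) (F k ∗ P) (suc n)
        ≡⟨ cong (P (suc n) +_) (shift-cong (suc k) (∗-congˡ P F≗geometric) (suc n)) ⟩
      P (suc n) + shift (suc k) (geometric k ∗ P) (suc n)
        ≡⟨ geometric-∗ k P (suc n) ⟨
      (geometric k ∗ P) (suc n)
        ≡⟨ ∗-congˡ P F≗geometric (suc n) ⟨
      (F k ∗ P) (suc n)
        ∎
    addLargest (atMostOnce F≗onePlus w-once w-twice) = begin
      P (suc n) + shift k largest n
        ≡⟨ cong (P (suc n) +_) (largest-cong largest≡P) ⟩
      P (suc n) + shift (suc k) P (suc n)
        ≡⟨ onePlus-∗ k P (suc n) ⟨
      (onePlus k ∗ P) (suc n)
        ≡⟨ ∗-congˡ P F≗onePlus (suc n) ⟨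
      (F k ∗ P) (suc n)
        ∎
      where
      largest≡P : ∀ r → r ≤ fuel → largest r ≡ P r
      largest≡P r r≤fuel = begin
        partitionSum fuel (w ∘ (suc k ∷_)) r (suc k)
          ≡⟨ partitionSum-suc fuel (w ∘ (suc k ∷_)) r k r≤fuel ⟩
        partitionSum fuel (w ∘ (suc k ∷_)) r k + shift (suc k) _ r
          ≡⟨ cong₂ _+_ (partitionSum-cong fuel k r w-once)
                       (trans (shift-cong (suc k) (λ r′ → partitionSum-vanishing (pred fuel) (suc k) r′
                                                             (λ μ _ → w-twice μ)) r)
                              (shift-0 (suc k) r)) ⟩
        partitionSum fuel w r k + 0
          ≡⟨ +-identityʳ _ ⟩
        partitionSum fuel w r k
          ≡⟨ partitionSum≡∏ k fuel r r≤fuel ⟩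
        P r
          ∎
    addLargest (forbidden F≗δ w-never) = begin
      P (suc n) + shift k largest n
        ≡⟨ cong (P (suc n) +_) (trans (largest-cong (λ r _ → partitionSum-vanishing fuel (suc k) r (λ μ _ → w-never μ)))
                                      (shift-0 k n)) ⟩
      P (suc n) + 0
        ≡⟨ +-identityʳ _ ⟩
      P (suc n)
        ≡⟨ ∗-identityˡ P (suc n) ⟨
      (δ ∗ P) (suc n)
        ≡⟨ ∗-congˡ P F≗δ (suc n) ⟨
      (F k ∗ P) (suc n)
        ∎

indicator : Bool → ℕ
indicator b = if b then 1 else 0

count-∷-≡ : ∀ k μ → count k (k ∷ μ) ≡ suc (count k μ)
count-∷-≡ k μ with k ≟ k
... | yes _   = refl
... | no k≢k = ⊥-elim (k≢k refl)

count-∷-≢ : ∀ {x k} μ → x ≢ k → count x (k ∷ μ) ≡ count x μ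
count-∷-≢ {x} {k} μ x≢k with x ≟ k
... | yes x≡k = ⊥-elim (x≢k x≡k)
... | no _    = refl

count-above : ∀ m μ → All (_≤ m) μ → count (suc m) μ ≡ 0
count-above m []       []           = refl
count-above m (y ∷ ys) (y≤m ∷ ys≤m) = trans (count-∷-≢ ys (λ { refl → 1+n≰n y≤m })) (count-above m ys ys≤m)

all-cong-All : ∀ {p q : ℕ → Bool} {Q : ℕ → Set} {xs} → All Q xs → (∀ {x} → Q x → p x ≡ q x) →
               all p xs ≡ all q xs
all-cong-All []         eq = refl
all-cong-All (qx ∷ qxs) eq = cong₂ _∧_ (eq qx) (all-cong-All qxs eq)

all-cong : ∀ {p q : ℕ → Bool} xs → p ≗ q → all p xs ≡ all q xs
all-cong []       eq = refl
all-cong (x ∷ xs) eq = cong₂ _∧_ (eq x) (all-cong xs eq)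

allMultiplicities : (ℕ → ℕ → Bool) → List ℕ → Bool
allMultiplicities P λ′ = all (λ x → P x (count x λ′)) λ′

module _ (P : ℕ → ℕ → Bool) where

  allMultiplicities-∷-free : ∀ k μ → (∀ c → P k c ≡ true) → allMultiplicities P (k ∷ μ) ≡ allMultiplicities P μ
  allMultiplicities-∷-free k μ free = cong₂ _∧_ (free _) (all-cong μ pointwise)
    where
    pointwise : ∀ x → P x (count x (k ∷ μ)) ≡ P x (count x μ)
    pointwise x = by-cases (x ≟ k)
      where
      by-cases : Dec (x ≡ k) → P x (count x (k ∷ μ)) ≡ P x (count x μ)
      by-cases (yes refl) = trans (free _) (sym (free _))
      by-cases (no x≢k)   = cong (P x) (count-∷-≢ μ x≢k)

  allMultiplicities-∷-new : ∀ m μ → All (_≤ m) μ →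
                            allMultiplicities P (suc m ∷ μ) ≡ P (suc m) 1 ∧ allMultiplicities P μ
  allMultiplicities-∷-new m μ μ≤m =
    cong₂ _∧_ (cong (P (suc m)) (trans (count-∷-≡ (suc m) μ) (cong suc (count-above m μ μ≤m))))
              (all-cong-All μ≤m (λ {x} x≤m → cong (P x) (count-∷-≢ μ (λ { refl → 1+n≰n x≤m }))))

  allMultiplicities-∷-forbidden : ∀ k μ → (∀ c → P k (suc c) ≡ false) → allMultiplicities P (k ∷ μ) ≡ false
  allMultiplicities-∷-forbidden k μ never =
    cong (_∧ all (λ x → P x (count x (k ∷ μ))) μ) (trans (cong (P k) (count-∷-≡ k μ)) (never _))

  allMultiplicities-∷-repeated : ∀ k μ → (∀ c → P k (suc (suc c)) ≡ false) →
                                 allMultiplicities P (k ∷ k ∷ μ) ≡ false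
  allMultiplicities-∷-repeated k μ never-twice = cong (_∧ all (λ x → P x (count x (k ∷ k ∷ μ))) (k ∷ μ)) (begin
    P k (count k (k ∷ k ∷ μ))     ≡⟨ cong (P k) (count-∷-≡ k (k ∷ μ)) ⟩
    P k (suc (count k (k ∷ μ)))   ≡⟨ cong (P k ∘ suc) (count-∷-≡ k μ) ⟩
    P k (suc (suc (count k μ)))   ≡⟨ never-twice _ ⟩
    false                         ∎)

  multiplicityWeight : Weight
  multiplicityWeight = indicator ∘ allMultiplicities P

  unrestrictedRule : ∀ {F} k → (∀ c → P (suc k) c ≡ true) → F k ≗ geometric k →
                     PartRule multiplicityWeight F k
  unrestrictedRule k free F≗ = unrestricted F≗ (λ μ → cong indicator (allMultiplicities-∷-free (suc k) μ free))

  atMostOnceRule : ∀ {F} k → P (suc k) 1 ≡ true → (∀ c → P (suc k) (suc (suc c)) ≡ false) → F k ≗ onePlus k →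
                   PartRule multiplicityWeight F k
  atMostOnceRule k once never-twice F≗ = atMostOnce F≗
    (λ μ μ≤k → cong indicator (trans (allMultiplicities-∷-new k μ μ≤k) (cong (_∧ allMultiplicities P μ) once)))
    (λ μ → cong indicator (allMultiplicities-∷-repeated (suc k) μ never-twice))

  forbiddenRule : ∀ {F} k → (∀ c → P (suc k) (suc c) ≡ false) → F k ≗ δ → PartRule multiplicityWeight F k
  forbiddenRule k never F≗ = forbidden F≗ (λ μ → cong indicator (allMultiplicities-∷-forbidden (suc k) μ never))

length-filter-partitions : ∀ (p : List ℕ → Bool) n →
                           length (filter (T? ∘ p) (partitions n)) ≡ partitionSum n (indicator ∘ p) n n
length-filter-partitions p n =
  trans (length-filter≡sum (T? ∘ p) (partitions n)) (sum-map-go n n n (indicator ∘ p) n n)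

-- As for `go`, unification names the local predicate of `oddPartsDistinct`.
oddPartAllowed : List ℕ → ℕ → Bool
oddPartsDistinct≡all : ∀ λ′ → oddPartsDistinct λ′ ≡ all (oddPartAllowed λ′) λ′
oddPartAllowed = _
oddPartsDistinct≡all λ′ = refl

oddAtMostOnce : ℕ → ℕ → Bool
oddAtMostOnce x c = not (isOdd x) ∨ ⌊ c ≤? 1 ⌋

oddPartAllowed≡oddAtMostOnce : ∀ λ′ x → oddPartAllowed λ′ x ≡ oddAtMostOnce x (count x λ′)
oddPartAllowed≡oddAtMostOnce λ′ x with not (isOdd x)
... | true  = refl
... | false = refl

podRule : ∀ k → PartRule (multiplicityWeight oddAtMostOnce) podFactor k
podRule k with parity (suc k)
... | inj₁ (odd , _)    = atMostOnceRule oddAtMostOnce k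
                            (cong (λ b → not b ∨ true) odd) (λ _ → cong (λ b → not b ∨ false) odd)
                            (λ n → cong (λ b → (if b then onePlus k else geometric k) n) odd)
... | inj₂ (notOdd , _) = unrestrictedRule oddAtMostOnce k
                            (λ c → cong (λ b → not b ∨ ⌊ c ≤? 1 ⌋) notOdd)
                            (λ n → cong (λ b → (if b then onePlus k else geometric k) n) notOdd)

pod≡∏ : ∀ n → pod n ≡ ∏< podFactor n n
pod≡∏ n = begin
  pod n                                                     ≡⟨ length-filter-partitions oddPartsDistinct n ⟩
  partitionSum n (indicator ∘ oddPartsDistinct) n n         ≡⟨ partitionSum-cong n n n (λ μ _ → cong indicator
                                                                 (all-cong μ (oddPartAllowed≡oddAtMostOnce μ))) ⟩
  partitionSum n (multiplicityWeight oddAtMostOnce) n n     ≡⟨ partitionSum≡∏ n n n ≤-refl ⟩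
  ∏< podFactor n n                                          ∎
  where open ProductFormula (multiplicityWeight oddAtMostOnce) podFactor
                            podFactor-trivialBelow refl podRule

evenAtMostOnce : ℕ → ℕ → Bool
evenAtMostOnce x c = isEven x ∧ ⌊ c ≤? 1 ⌋

distinctEvenRule : ∀ k → PartRule (multiplicityWeight evenAtMostOnce) distinctEvenFactor k
distinctEvenRule k with parity (suc k)
... | inj₁ (_ , notEven) = forbiddenRule evenAtMostOnce k
                             (λ c → cong (_∧ ⌊ suc c ≤? 1 ⌋) notEven)
                             (λ n → cong (λ b → (if b then onePlus k else δ) n) notEven)
... | inj₂ (_ , even)    = atMostOnceRule evenAtMostOnce k
                             (cong (_∧ true) even) (λ _ → cong (_∧ false) even)
                             (λ n → cong (λ b → (if b then onePlus k else δ) n) even)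

distinctEvenCount≡∏ : ∀ n → distinctEvenCount n ≡ ∏< distinctEvenFactor n n
distinctEvenCount≡∏ n =
  trans (length-filter-partitions distinctEven n) (partitionSum≡∏ n n n ≤-refl)
  where open ProductFormula (multiplicityWeight evenAtMostOnce) distinctEvenFactor
                            distinctEvenFactor-trivialBelow refl distinctEvenRule

containsUpTo : ℕ → List ℕ → Bool
containsUpTo zero    μ = true
containsUpTo (suc t) μ = (suc t ∈ᵇ μ) ∧ containsUpTo t μ

∈ᵇ-∷-≡ : ∀ k μ → (k ∈ᵇ (k ∷ μ)) ≡ true
∈ᵇ-∷-≡ k μ with k ≟ k
... | yes _   = refl
... | no k≢k = ⊥-elim (k≢k refl)

∈ᵇ-∷-≢ : ∀ {s k} μ → s ≢ k → (s ∈ᵇ (k ∷ μ)) ≡ (s ∈ᵇ μ)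
∈ᵇ-∷-≢ {s} {k} μ s≢k with s ≟ k
... | yes s≡k = ⊥-elim (s≢k s≡k)
... | no _    = refl

∈ᵇ-above : ∀ m s μ → All (_≤ m) μ → m < s → (s ∈ᵇ μ) ≡ false
∈ᵇ-above m s []       []           m<s = refl
∈ᵇ-above m s (y ∷ ys) (y≤m ∷ ys≤m) m<s =
  trans (∈ᵇ-∷-≢ ys (λ { refl → <⇒≱ m<s y≤m })) (∈ᵇ-above m s ys ys≤m m<s)

∈ᵇ⇒∈ : ∀ s μ → (s ∈ᵇ μ) ≡ true → s ∈ μ
∈ᵇ⇒∈ s (y ∷ ys) s∈ᵇμ with s ≟ y
... | yes s≡y = here s≡y
... | no _    = there (∈ᵇ⇒∈ s ys s∈ᵇμ)

containsUpTo-∷-above : ∀ t k μ → t < k → containsUpTo t (k ∷ μ) ≡ containsUpTo t μ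
containsUpTo-∷-above zero    k μ _   = refl
containsUpTo-∷-above (suc t) k μ t<k =
  cong₂ _∧_ (∈ᵇ-∷-≢ μ (<⇒≢ t<k)) (containsUpTo-∷-above t k μ (<-trans (n<1+n t) t<k))

containsUpTo-∷-top : ∀ t μ → containsUpTo (suc t) (suc t ∷ μ) ≡ containsUpTo t μ
containsUpTo-∷-top t μ = cong₂ _∧_ (∈ᵇ-∷-≡ (suc t) μ) (containsUpTo-∷-above t (suc t) μ (n<1+n t))

containsUpTo-above : ∀ m t μ → All (_≤ m) μ → m < t → containsUpTo t μ ≡ false
containsUpTo-above m (suc t) μ μ≤m m<t = cong (_∧ containsUpTo t μ) (∈ᵇ-above m (suc t) μ μ≤m m<t)

containsUpTo⇒∈ᵇ : ∀ t μ → containsUpTo t μ ≡ true → ∀ s → 0 < s → s ≤ t → (s ∈ᵇ μ) ≡ true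
containsUpTo⇒∈ᵇ zero    μ contains (suc s) 0<s ()
containsUpTo⇒∈ᵇ (suc t) μ contains s 0<s s≤t
  with suc t ∈ᵇ μ in t∈μ | containsUpTo t μ in rest | m≤n⇒m<n∨m≡n s≤t
... | true | true | inj₁ s<t  = containsUpTo⇒∈ᵇ t μ rest s 0<s (≤-pred s<t)
... | true | true | inj₂ refl = t∈μ

-- `mex` searches only up to length μ + 1; by pigeonhole that suffices.
containsUpTo⇒≤length : ∀ t μ → containsUpTo t μ ≡ true → t ≤ length μ
containsUpTo⇒≤length t μ contains with t ≤? length μ
... | yes t≤len = t≤len
... | no  t≰len = ⊥-elim (injective (pigeonhole (≰⇒> t≰len) position))
  where
  occurs : (s : Fin t) → suc (toℕ s) ∈ μ
  occurs s = ∈ᵇ⇒∈ (suc (toℕ s)) μ (containsUpTo⇒∈ᵇ t μ contains (suc (toℕ s)) (s≤s z≤n) (toℕ<n s))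
  position : Fin t → Fin (length μ)
  position s = index (occurs s)
  value : ∀ s → suc (toℕ s) ≡ lookup μ (position s)
  value s = lookup-index (occurs s)
  injective : ∃₂ (λ i j → toℕ i < toℕ j × position i ≡ position j) → ⊥
  injective (i , j , i<j , same) =
    <-irrefl (suc-injective (trans (value i) (trans (cong (lookup μ) same) (sym (value j))))) i<j

mexFrom≡∑ : ∀ fuel k μ → containsUpTo k μ ≡ true →
            mexFrom fuel (suc k) μ ≡ suc k + ∑[ j < fuel ] indicator (containsUpTo (suc k + j) μ)
mexFrom≡∑ zero       k μ _ = sym (+-identityʳ (suc k))
mexFrom≡∑ (suc fuel) k μ contains-k with suc k ∈ᵇ μ in k+1∈μ
... | true = begin
  mexFrom fuel (suc (suc k)) μ
    ≡⟨ mexFrom≡∑ fuel (suc k) μ contains-k+1 ⟩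
  suc (suc k) + ∑[ j < fuel ] indicator (containsUpTo (suc (suc k) + j) μ)
    ≡⟨ cong (suc (suc k) +_) (∑-cong fuel (λ j _ →
         cong (λ i → indicator (containsUpTo i μ)) (sym (+-suc (suc k) j)))) ⟩
  suc (suc k) + ∑[ j < fuel ] indicator (containsUpTo (suc k + suc j) μ)
    ≡⟨ +-suc (suc k) _ ⟨
  suc k + (1 + ∑[ j < fuel ] indicator (containsUpTo (suc k + suc j) μ))
    ≡⟨ cong (λ x → suc k + (x + ∑[ j < fuel ] indicator (containsUpTo (suc k + suc j) μ))) first ⟨
  suc k + ∑[ j < suc fuel ] indicator (containsUpTo (suc k + j) μ)
    ∎
  where
  contains-k+1 : containsUpTo (suc k) μ ≡ true
  contains-k+1 = cong₂ _∧_ k+1∈μ contains-k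
  first : indicator (containsUpTo (suc k + 0) μ) ≡ 1
  first = cong indicator (trans (cong (λ i → containsUpTo i μ) (+-identityʳ (suc k))) contains-k+1)
... | false = sym (trans (cong (suc k +_) (∑-vanishing (suc fuel) (λ j _ → missing j))) (+-identityʳ (suc k)))
  where
  missing : ∀ j → indicator (containsUpTo (suc k + j) μ) ≡ 0
  missing j with containsUpTo (suc k + j) μ in contains
  ... | false = refl
  ... | true with trans (sym (containsUpTo⇒∈ᵇ (suc k + j) μ contains (suc k) (s≤s z≤n) (m≤m+n (suc k) j)))
                        k+1∈μ
  ...   | ()

mex≡∑ : ∀ N μ → All (_≤ N) μ → mex μ ≡ ∑[ t < suc N ] indicator (containsUpTo t μ)
mex≡∑ N μ μ≤N = trans (mexFrom≡∑ (suc (length μ)) 0 μ refl) (∑-range-stable _ beyondLength beyondParts)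
  where
  beyondLength : ∀ t → suc (suc (length μ)) ≤ t → indicator (containsUpTo t μ) ≡ 0
  beyondLength t len<t with containsUpTo t μ in contains
  ... | false = refl
  ... | true  = ⊥-elim (<⇒≱ len<t (m≤n⇒m≤1+n (containsUpTo⇒≤length t μ contains)))
  beyondParts : ∀ t → suc N ≤ t → indicator (containsUpTo t μ) ≡ 0
  beyondParts t N<t = cong indicator (containsUpTo-above N t μ μ≤N N<t)

module AllPartitions = ProductFormula (λ _ → 1) geometric geometric-trivialBelow refl
                                      (λ k → unrestricted (λ _ → refl) (λ _ → refl))

partitionSum-containsUpTo : ∀ t m → t ≤ m → ∀ fuel n → n ≤ fuel →
  partitionSum fuel (indicator ∘ containsUpTo t) n m ≡ shift (tri t) (∏< geometric m) n
partitionSum-containsUpTo zero    m       _         fuel       n       n≤fuel =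
  AllPartitions.partitionSum≡∏ m fuel n n≤fuel
partitionSum-containsUpTo (suc t) (suc m) _         fuel       zero    _      = refl
partitionSum-containsUpTo (suc t) (suc m) (s≤s t≤m) (suc fuel) (suc n) (s≤s n≤fuel) with m≤n⇒m<n∨m≡n t≤m
... | inj₁ t<m = begin
  partitionSum (suc fuel) w (suc n) (suc m)
    ≡⟨ partitionSum-suc (suc fuel) w (suc n) m (s≤s n≤fuel) ⟩
  partitionSum (suc fuel) w (suc n) m + shift m (λ r → partitionSum fuel (w ∘ (suc m ∷_)) r (suc m)) n
    ≡⟨ cong₂ _+_ (partitionSum-containsUpTo (suc t) m t<m (suc fuel) (suc n) (s≤s n≤fuel))
                 (shift-cong-≤ m n (λ r r≤n → largest r (≤-trans r≤n n≤fuel))) ⟩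
  shift (tri (suc t)) P (suc n) + shift m (shift (tri (suc t)) Z) n
    ≡⟨ cong (shift (tri (suc t)) P (suc n) +_) (shift-comm (tri (suc t)) (suc m) Z (suc n)) ⟨
  shift (tri (suc t)) P (suc n) + shift (tri (suc t)) (shift (suc m) Z) (suc n)
    ≡⟨ shift-⊕ (tri (suc t)) P (shift (suc m) Z) (suc n) ⟨
  shift (tri (suc t)) (P ⊕ shift (suc m) Z) (suc n)
    ≡⟨ shift-cong (tri (suc t)) (geometric-∗ m P) (suc n) ⟨
  shift (tri (suc t)) Z (suc n)
    ∎
  where
  w : Weight
  w = indicator ∘ containsUpTo (suc t)
  P Z : Series
  P = ∏< geometric m
  Z = ∏< geometric (suc m)
  largest : ∀ r → r ≤ fuel → partitionSum fuel (w ∘ (suc m ∷_)) r (suc m) ≡ shift (tri (suc t)) Z r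
  largest r r≤fuel = begin
    partitionSum fuel (w ∘ (suc m ∷_)) r (suc m)
      ≡⟨ partitionSum-cong fuel (suc m) r (λ μ _ → cong indicator (containsUpTo-∷-above (suc t) (suc m) μ (s≤s t<m))) ⟩
    partitionSum fuel w r (suc m)
      ≡⟨ partitionSum-containsUpTo (suc t) (suc m) (s≤s t≤m) fuel r r≤fuel ⟩
    shift (tri (suc t)) Z r
      ∎
... | inj₂ refl = begin
  partitionSum (suc fuel) w (suc n) (suc t)
    ≡⟨ partitionSum-suc (suc fuel) w (suc n) t (s≤s n≤fuel) ⟩
  partitionSum (suc fuel) w (suc n) t + shift t (λ r → partitionSum fuel (w ∘ (suc t ∷_)) r (suc t)) n
    ≡⟨ cong₂ _+_ (partitionSum-vanishing (suc fuel) t (suc n) (λ μ μ≤t →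
                    cong indicator (containsUpTo-above t (suc t) μ μ≤t ≤-refl)))
                 (shift-cong-≤ t n (λ r r≤n → largest r (≤-trans r≤n n≤fuel))) ⟩
  shift t (shift (tri t) X) n
    ≡⟨ shift-+ t (tri t) X n ⟨
  shift (tri (suc t)) X (suc n)
    ∎
  where
  w : Weight
  w = indicator ∘ containsUpTo (suc t)
  X : Series
  X = ∏< geometric (suc t)
  largest : ∀ r → r ≤ fuel → partitionSum fuel (w ∘ (suc t ∷_)) r (suc t) ≡ shift (tri t) X r
  largest r r≤fuel = begin
    partitionSum fuel (w ∘ (suc t ∷_)) r (suc t)
      ≡⟨ partitionSum-cong fuel (suc t) r (λ μ _ → cong indicator (containsUpTo-∷-top t μ)) ⟩
    partitionSum fuel (indicator ∘ containsUpTo t) r (suc t)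
      ≡⟨ partitionSum-containsUpTo t (suc t) (n≤1+n t) fuel r r≤fuel ⟩
    shift (tri t) X r
      ∎

σmex≡∑-shift-∏ : ∀ n → σmex n ≡ ∑[ t < suc n ] shift (tri t) (∏< geometric n) n
σmex≡∑-shift-∏ n = begin
  sum (map mex (partitions n))
    ≡⟨ sum-map-go n n n mex n n ⟩
  partitionSum n mex n n
    ≡⟨ partitionSum-cong n n n (mex≡∑ n) ⟩
  partitionSum n (λ μ → ∑[ t < suc n ] indicator (containsUpTo t μ)) n n
    ≡⟨ partitionSum-∑ (suc n) n n n (λ t → indicator ∘ containsUpTo t) ⟩
  ∑[ t < suc n ] partitionSum n (indicator ∘ containsUpTo t) n n
    ≡⟨ ∑-cong (suc n) (λ t t≤n → partitionSum-containsUpTo t n (≤-pred t≤n) n n ≤-refl) ⟩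
  ∑[ t < suc n ] shift (tri t) (∏< geometric n) n
    ∎

D₂*≡∑-shift : ∀ {n} m → m ≤ n → D₂* m ≡ ∑[ t < suc n ] shift (tri t) distinctEvenCount m
D₂*≡∑-shift {n} m m≤n = begin
  D₂* m
    ≡⟨ sum-map-applyUpTo _ (λ t → t) (suc m) ⟩
  ∑[ t < suc m ] (if ⌊ tri t ≤? m ⌋ then distinctEvenCount (m ∸ tri t) else 0)
    ≡⟨ ∑-cong (suc m) (λ t _ → cong (λ b → if b then distinctEvenCount (m ∸ tri t) else 0)
                                    (isYes≗does (tri t ≤? m))) ⟩
  ∑[ t < suc m ] (if tri t ≤ᵇ m then distinctEvenCount (m ∸ tri t) else 0)
    ≡⟨ ∑-cong (suc m) (λ t _ → shift-≤ᵇ (tri t) distinctEvenCount m) ⟨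
  ∑[ t < suc m ] shift (tri t) distinctEvenCount m
    ≡⟨ ∑-extend _ (s≤s m≤n) (λ t m<t → shift-below (tri t) distinctEvenCount m (<-≤-trans m<t (t≤tri t))) ⟨
  ∑[ t < suc n ] shift (tri t) distinctEvenCount m
    ∎
  where
  t≤tri : ∀ t → t ≤ tri t
  t≤tri zero    = z≤n
  t≤tri (suc t) = m≤m+n (suc t) (tri t)

convolution≡∑-shift : ∀ n →
  Σ≤ n (λ j → pod j * D₂* (n ∸ j)) ≡ ∑[ t < suc n ] shift (tri t) (pod ∗ distinctEvenCount) n
convolution≡∑-shift n = begin
  Σ≤ n (λ j → pod j * D₂* (n ∸ j))
    ≡⟨ sum-map-applyUpTo (λ j → pod j * D₂* (n ∸ j)) (λ j → j) (suc n) ⟩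
  ∑[ j < suc n ] (pod j * D₂* (n ∸ j))
    ≡⟨ ∗-def pod D₂* n ⟨
  (pod ∗ D₂*) n
    ≡⟨ ∗-cong-≤ n (λ _ _ → refl) D₂*≡∑-shift ⟩
  (pod ∗ (λ m → ∑[ t < suc n ] shift (tri t) distinctEvenCount m)) n
    ≡⟨ ∗-distribˡ-∑ (suc n) pod (λ t → shift (tri t) distinctEvenCount) n ⟩
  ∑[ t < suc n ] (pod ∗ shift (tri t) distinctEvenCount) n
    ≡⟨ ∑-cong (suc n) (λ t _ → ∗-shift (tri t) pod distinctEvenCount n) ⟩
  ∑[ t < suc n ] shift (tri t) (pod ∗ distinctEvenCount) n
    ∎

∏-geometric≡pod∗distinctEvenCount : ∀ m n → n ≤ m → ∏< geometric m n ≡ (pod ∗ distinctEvenCount) n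
∏-geometric≡pod∗distinctEvenCount m n n≤m = begin
  ∏< geometric m n
    ≡⟨ ∏-podFactor-∗-∏-distinctEvenFactor m n n≤m ⟨
  (∏< podFactor m ∗ ∏< distinctEvenFactor m) n
    ≡⟨ ∗-cong-≤ n (λ i i≤n → trans (stable podFactor-trivialBelow i≤n) (sym (pod≡∏ i)))
                  (λ i i≤n → trans (stable distinctEvenFactor-trivialBelow i≤n) (sym (distinctEvenCount≡∏ i))) ⟩
  (pod ∗ distinctEvenCount) n
    ∎
  where
  stable : ∀ {F} → TrivialBelow F → ∀ {i} → i ≤ n → ∏< F m i ≡ ∏< F i i
  stable triv {i} i≤n = ∏-stable triv i ≤-refl (≤-trans i≤n n≤m)

corollary4 : (n : ℕ) → σmex n ≡ Σ≤ n (λ j → pod j * D₂* (n ∸ j))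
corollary4 n = begin
  σmex n
    ≡⟨ σmex≡∑-shift-∏ n ⟩
  ∑[ t < suc n ] shift (tri t) (∏< geometric n) n
    ≡⟨ ∑-cong (suc n) (λ t _ → shift-cong-≤ (tri t) n (∏-geometric≡pod∗distinctEvenCount n)) ⟩
  ∑[ t < suc n ] shift (tri t) (pod ∗ distinctEvenCount) n
    ≡⟨ convolution≡∑-shift n ⟨
  Σ≤ n (λ j → pod j * D₂* (n ∸ j))
    ∎
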